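{- Let $\mathcal{C}$ be a compact closed category. Then $\mathcal{C}_{\mathcal{P}^+_\omega}$ (defined below) is a compact closed category, whose monoidal product agrees with that of $\mathcal{C}$ on objects and on morphisms is given by $U\otimes U'=\{u\otimes u'\mid u\in U,u'\in U'\}$, and there is a strict monoidal embedding $\mathcal{C}\to\mathcal{C}_{\mathcal{P}^+_\omega}$ that is the identity on objects (sending $f\mapsto\{f\}$). Moreover, if $\mathcal{C}$ is dagger compact closed, then $\mathcal{C}_{\mathcal{P}^+_\omega}$ is dagger compact closed with dagger $U^{\dagger}=\{u^\dagger\mid u\in U\}$.
   Context: For a category $\mathcal{C}$, $\mathcal{C}_{\mathcal{P}^+_\omega}$ has the same objects as $\mathcal{C}$, hom-sets $\mathcal{C}_{\mathcal{P}^+_\omega}(A,B)$ = the set of non-empty finite subsets of $\mathcal{C}(A,B)$, composition $V\circ U=\{v\circ u\mid v\in V,u\in U\}$, and identities the singletons $\{1_A\}$. Structural isomorphisms and cups/caps are the singletons of those of $\mathcal{C}$. -}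

module Defs where

open import Level using (Level; _⊔_) renaming (suc to lsuc)
open import Relation.Binary using (Rel; IsEquivalence)
open import Data.Product using (_×_; _,_)
open import Data.List.NonEmpty as L⁺ using (List⁺; [_])
open import Data.List.Relation.Unary.All using (All)
open import Data.List.Relation.Unary.Any using (Any)

record RawCategory (o ℓ e : Level) : Set (lsuc (o ⊔ ℓ ⊔ e)) where
  infix  4 _≈_
  infixr 9 _∘_
  field
    Obj : Set o
    _⇒_ : Obj → Obj → Set ℓ
    _≈_ : ∀ {A B} → Rel (A ⇒ B) e
    id  : ∀ {A} → A ⇒ A
    _∘_ : ∀ {A B C} → B ⇒ C → A ⇒ B → A ⇒ C

record IsCategory {o ℓ e} (C : RawCategory o ℓ e) : Set (o ⊔ ℓ ⊔ e) where
  open RawCategory C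
  field
    equiv     : ∀ {A B} → IsEquivalence (_≈_ {A} {B})
    assoc     : ∀ {A B C D} {f : A ⇒ B} {g : B ⇒ C} {h : C ⇒ D} →
                (h ∘ g) ∘ f ≈ h ∘ (g ∘ f)
    identityˡ : ∀ {A B} {f : A ⇒ B} → id ∘ f ≈ f
    identityʳ : ∀ {A B} {f : A ⇒ B} → f ∘ id ≈ f
    ∘-resp-≈  : ∀ {A B C} {f h : B ⇒ C} {g i : A ⇒ B} →
                f ≈ h → g ≈ i → f ∘ g ≈ h ∘ i

record Category (o ℓ e : Level) : Set (lsuc (o ⊔ ℓ ⊔ e)) where
  field
    raw        : RawCategory o ℓ e
    isCategory : IsCategory raw
  open RawCategory raw public
  open IsCategory isCategory public

record CCData {o ℓ e} (C : RawCategory o ℓ e) : Set (o ⊔ ℓ) where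
  open RawCategory C
  infixr 10 _⊗₀_ _⊗₁_
  field
    unit : Obj
    _⊗₀_ : Obj → Obj → Obj
    _⊗₁_ : ∀ {A B X Y} → A ⇒ B → X ⇒ Y → (A ⊗₀ X) ⇒ (B ⊗₀ Y)
    α⇒ : ∀ A B X → ((A ⊗₀ B) ⊗₀ X) ⇒ (A ⊗₀ (B ⊗₀ X))
    α⇐ : ∀ A B X → (A ⊗₀ (B ⊗₀ X)) ⇒ ((A ⊗₀ B) ⊗₀ X)
    λ⇒ : ∀ A → (unit ⊗₀ A) ⇒ A
    λ⇐ : ∀ A → A ⇒ (unit ⊗₀ A)
    ρ⇒ : ∀ A → (A ⊗₀ unit) ⇒ A
    ρ⇐ : ∀ A → A ⇒ (A ⊗₀ unit)
    σ  : ∀ A B → (A ⊗₀ B) ⇒ (B ⊗₀ A)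
    dual : Obj → Obj
    η  : ∀ A → unit ⇒ (dual A ⊗₀ A)
    ε  : ∀ A → (A ⊗₀ dual A) ⇒ unit

record IsCompactClosed {o ℓ e} (C : RawCategory o ℓ e) (D : CCData C)
       : Set (o ⊔ ℓ ⊔ e) where
  open RawCategory C
  open CCData D
  field
    ⊗-identity : ∀ {A B} → id {A} ⊗₁ id {B} ≈ id
    ⊗-homo     : ∀ {A B X Y Z W} {f : A ⇒ B} {g : B ⇒ X} {h : Y ⇒ Z} {i : Z ⇒ W} →
                 (g ∘ f) ⊗₁ (i ∘ h) ≈ (g ⊗₁ i) ∘ (f ⊗₁ h)
    ⊗-resp-≈   : ∀ {A B X Y} {f f′ : A ⇒ B} {g g′ : X ⇒ Y} →
                 f ≈ f′ → g ≈ g′ → f ⊗₁ g ≈ f′ ⊗₁ g′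
    α-isoˡ : ∀ A B X → α⇐ A B X ∘ α⇒ A B X ≈ id
    α-isoʳ : ∀ A B X → α⇒ A B X ∘ α⇐ A B X ≈ id
    λ-isoˡ : ∀ A → λ⇐ A ∘ λ⇒ A ≈ id
    λ-isoʳ : ∀ A → λ⇒ A ∘ λ⇐ A ≈ id
    ρ-isoˡ : ∀ A → ρ⇐ A ∘ ρ⇒ A ≈ id
    ρ-isoʳ : ∀ A → ρ⇒ A ∘ ρ⇐ A ≈ id
    α-natural : ∀ {A B X Y Z W} (f : A ⇒ B) (g : X ⇒ Y) (h : Z ⇒ W) →
                α⇒ B Y W ∘ ((f ⊗₁ g) ⊗₁ h) ≈ (f ⊗₁ (g ⊗₁ h)) ∘ α⇒ A X Z
    λ-natural : ∀ {A B} (f : A ⇒ B) → λ⇒ B ∘ (id {unit} ⊗₁ f) ≈ f ∘ λ⇒ A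
    ρ-natural : ∀ {A B} (f : A ⇒ B) → ρ⇒ B ∘ (f ⊗₁ id {unit}) ≈ f ∘ ρ⇒ A
    σ-natural : ∀ {A B X Y} (f : A ⇒ B) (g : X ⇒ Y) →
                σ B Y ∘ (f ⊗₁ g) ≈ (g ⊗₁ f) ∘ σ A X
    triangle : ∀ A B → (id {A} ⊗₁ λ⇒ B) ∘ α⇒ A unit B ≈ ρ⇒ A ⊗₁ id {B}
    pentagon : ∀ A B X Y →
               (id {A} ⊗₁ α⇒ B X Y) ∘ (α⇒ A (B ⊗₀ X) Y ∘ (α⇒ A B X ⊗₁ id {Y}))
               ≈ α⇒ A B (X ⊗₀ Y) ∘ α⇒ (A ⊗₀ B) X Y
    hexagon  : ∀ A B X →
               (id {B} ⊗₁ σ A X) ∘ (α⇒ B A X ∘ (σ A B ⊗₁ id {X}))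
               ≈ α⇒ B X A ∘ (σ A (B ⊗₀ X) ∘ α⇒ A B X)
    σ-involutive : ∀ A B → σ B A ∘ σ A B ≈ id
    snake₁ : ∀ A → λ⇒ A ∘ ((ε A ⊗₁ id {A}) ∘ (α⇐ A (dual A) A ∘ ((id {A} ⊗₁ η A) ∘ ρ⇐ A)))
                   ≈ id
    snake₂ : ∀ A → ρ⇒ (dual A) ∘ ((id {dual A} ⊗₁ ε A) ∘ (α⇒ (dual A) A (dual A)
                   ∘ ((η A ⊗₁ id {dual A}) ∘ λ⇐ (dual A))))
                   ≈ id

record DaggerData {o ℓ e} (C : RawCategory o ℓ e) : Set (o ⊔ ℓ) where
  open RawCategory C
  field
    _† : ∀ {A B} → A ⇒ B → B ⇒ A

record IsDaggerCompactClosed {o ℓ e} (C : RawCategory o ℓ e) (D : CCData C)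
       (Dg : DaggerData C) : Set (o ⊔ ℓ ⊔ e) where
  open RawCategory C
  open CCData D
  open DaggerData Dg
  field
    isCompactClosed : IsCompactClosed C D
    †-identity   : ∀ {A} → (id {A}) † ≈ id
    †-homo       : ∀ {A B X} {f : A ⇒ B} {g : B ⇒ X} → (g ∘ f) † ≈ (f †) ∘ (g †)
    †-involutive : ∀ {A B} (f : A ⇒ B) → (f †) † ≈ f
    †-resp-≈     : ∀ {A B} {f g : A ⇒ B} → f ≈ g → f † ≈ g †
    †-⊗          : ∀ {A B X Y} (f : A ⇒ B) (g : X ⇒ Y) → (f ⊗₁ g) † ≈ (f †) ⊗₁ (g †)
    α-unitary    : ∀ A B X → α⇐ A B X ≈ (α⇒ A B X) †
    λ-unitary    : ∀ A → λ⇐ A ≈ (λ⇒ A) †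
    ρ-unitary    : ∀ A → ρ⇐ A ≈ (ρ⇒ A) †
    σ-unitary    : ∀ A B → σ B A ≈ (σ A B) †
    η-ε          : ∀ A → η A ≈ σ A (dual A) ∘ (ε A †)

-- The construction C_{P⁺_ω}: morphisms are non-empty finite subsets of
-- hom-sets, represented as non-empty lists modulo having the same
-- elements (up to the equality ≈ of C).

module _ {o ℓ e} (C : RawCategory o ℓ e) where
  open RawCategory C

  _∈ₚ_ : ∀ {A B} → A ⇒ B → List⁺ (A ⇒ B) → Set (ℓ ⊔ e)
  u ∈ₚ U = Any (u ≈_) (L⁺.toList U)

  _⊆ₚ_ : ∀ {A B} → List⁺ (A ⇒ B) → List⁺ (A ⇒ B) → Set (ℓ ⊔ e)
  U ⊆ₚ V = All (_∈ₚ V) (L⁺.toList U)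

  _≈ₚ_ : ∀ {A B} → List⁺ (A ⇒ B) → List⁺ (A ⇒ B) → Set (ℓ ⊔ e)
  U ≈ₚ V = (U ⊆ₚ V) × (V ⊆ₚ U)

  image₂ : ∀ {X Y Z : Set ℓ} → (X → Y → Z) → List⁺ X → List⁺ Y → List⁺ Z
  image₂ f U V = L⁺.concatMap (λ u → L⁺.map (f u) V) U

  _∘ₚ_ : ∀ {A B X} → List⁺ (B ⇒ X) → List⁺ (A ⇒ B) → List⁺ (A ⇒ X)
  V ∘ₚ U = image₂ _∘_ V U

  -- C_{P⁺_ω} as raw category (same objects, identities {1_A});
  -- that it satisfies the category axioms is part of the theorem.
  PCat : RawCategory o ℓ (ℓ ⊔ e)
  PCat = record
    { Obj = Obj
    ; _⇒_ = λ A B → List⁺ (A ⇒ B)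
    ; _≈_ = _≈ₚ_
    ; id  = [ id ]
    ; _∘_ = _∘ₚ_
    }

  PData : CCData C → CCData PCat
  PData D = record
    { unit = unit
    ; _⊗₀_ = _⊗₀_
    ; _⊗₁_ = image₂ _⊗₁_
    ; α⇒ = λ A B X → [ α⇒ A B X ]
    ; α⇐ = λ A B X → [ α⇐ A B X ]
    ; λ⇒ = λ A → [ λ⇒ A ]
    ; λ⇐ = λ A → [ λ⇐ A ]
    ; ρ⇒ = λ A → [ ρ⇒ A ]
    ; ρ⇐ = λ A → [ ρ⇐ A ]
    ; σ  = λ A B → [ σ A B ]
    ; dual = dual
    ; η  = λ A → [ η A ]
    ; ε  = λ A → [ ε A ]
    }
    where open CCData D

  PDagger : DaggerData C → DaggerData PCat
  PDagger Dg = record { _† = L⁺.map (DaggerData._† Dg) }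

  record IsSingletonEmbedding (D : CCData C) : Set (o ⊔ ℓ ⊔ e) where
    open CCData D
    private
      module P = RawCategory PCat
      module PD = CCData (PData D)
    field
      -- functoriality (identity preservation is definitional: {1_A})
      F-identity : ∀ {A} → [ id {A} ] P.≈ P.id
      F-homo     : ∀ {A B X} (f : A ⇒ B) (g : B ⇒ X) → [ g ∘ f ] P.≈ ([ g ] P.∘ [ f ])
      F-resp-≈   : ∀ {A B} {f g : A ⇒ B} → f ≈ g → [ f ] P.≈ [ g ]
      -- embedding: faithful (and the identity, hence injective, on objects)
      F-faithful : ∀ {A B} {f g : A ⇒ B} → [ f ] P.≈ [ g ] → f ≈ g
      -- strict monoidality (on objects F(A ⊗ B) = A ⊗ B and F(I) = I hold
      -- definitionally since F is the identity on objects)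
      F-⊗        : ∀ {A B X Y} (f : A ⇒ B) (g : X ⇒ Y) →
                   [ f ⊗₁ g ] P.≈ ([ f ] PD.⊗₁ [ g ])
      F-α⇒ : ∀ A B X → [ α⇒ A B X ] P.≈ PD.α⇒ A B X
      F-λ⇒ : ∀ A → [ λ⇒ A ] P.≈ PD.λ⇒ A
      F-ρ⇒ : ∀ A → [ ρ⇒ A ] P.≈ PD.ρ⇒ A
      F-σ  : ∀ A B → [ σ A B ] P.≈ PD.σ A B

module Submission where

-- The whole proof rests on two
-- facts:
--   * membership in a pairwise image (resp. a direct image) is exactly
--     "of the form f u v with u ∈ U, v ∈ V" (resp. "of the form g u");
--   * the finite-subset equality ≈ₚ is an equivalence relation, and images
--     are monotone for the inclusion ⊆ₚ when the operation respects ≈.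
-- With these, every law of C_{P⁺_ω} involving arbitrary morphisms (assoc,
-- functoriality of ⊗ and †, naturality, involutivity) follows by taking an
-- element of one side apart and rebuilding it on the other side, using the
-- corresponding law of C; every law between structural morphisms is a law
-- between singletons, hence the image of the law of C under f ↦ {f}.

open import Defs
open import Level using (_⊔_)
open import Data.Product using (Σ; _×_; _,_)
open import Relation.Binary using (Setoid; IsEquivalence)
open import Relation.Binary.PropositionalEquality using (_≡_; refl; cong; sym; subst)
open import Data.List.NonEmpty as L⁺ using (List⁺; [_]; _∷_; toList)
import Data.List as L
open import Data.List.Relation.Unary.All as All using ([]; _∷_)
open import Data.List.Relation.Unary.Any using (here; there)
open import Data.List.Membership.Propositional using (_∈_; find; lose)
open import Data.List.Membership.Propositional.Properties
  using (∈-map⁺; ∈-map⁻; ∈-cartesianProductWith⁺; ∈-cartesianProductWith⁻)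
open import Data.List.Membership.Setoid.Properties using (∈-resp-≈)

module FinitePowerset {o ℓ e} (C : Category o ℓ e) where
  open Category C
  private
    module ≈ {A B} = IsEquivalence (equiv {A} {B})

    module P = RawCategory (PCat raw)

    -- the hom-setoid C(A, B); ∈ₚ of Defs is list membership in it
    hom : Obj → Obj → Setoid ℓ e
    hom A B = record { isEquivalence = equiv {A} {B} }

    variable
      A B X Y Z W : Obj
      P Q S : Set ℓ

  infix 4 _∈⁺_ _∈≈_ _⊆≈_ _⊑_

  _∈⁺_ : P → List⁺ P → Set ℓ
  x ∈⁺ U = x ∈ toList U

  toList-image₂ : (f : P → Q → S) (U : List⁺ P) (V : List⁺ Q) →
                  toList (image₂ raw f U V) ≡ L.cartesianProductWith f (toList U) (toList V)
  toList-image₂ f (u ∷ us) (v ∷ vs) = cong (λ t → f u v L.∷ (L.map (f u) vs L.++ t)) (rest us)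
    where
    rest : ∀ us → L.concat (L.map toList (L.map (λ u → L⁺.map (f u) (v ∷ vs)) us))
                  ≡ L.cartesianProductWith f us (v L.∷ vs)
    rest L.[]        = refl
    rest (u L.∷ us) = cong (L.map (f u) (v L.∷ vs) L.++_) (rest us)

  data Image₂ (f : P → Q → S) (U : List⁺ P) (V : List⁺ Q) : S → Set ℓ where
    image : ∀ {u v} → u ∈⁺ U → v ∈⁺ V → Image₂ f U V (f u v)

  image₂⁻ : (f : P → Q → S) (U : List⁺ P) (V : List⁺ Q) →
            ∀ {x} → x ∈⁺ image₂ raw f U V → Image₂ f U V x
  image₂⁻ f U V {x} x∈ with ∈-cartesianProductWith⁻ f (toList U) (toList V)
                                (subst (x ∈_) (toList-image₂ f U V) x∈)
  ... | _ , _ , u∈ , v∈ , refl = image u∈ v∈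

  image₂⁺ : (f : P → Q → S) (U : List⁺ P) (V : List⁺ Q) →
            ∀ {u v} → u ∈⁺ U → v ∈⁺ V → f u v ∈⁺ image₂ raw f U V
  image₂⁺ f U V {u} {v} u∈ v∈ =
    subst (f u v ∈_) (sym (toList-image₂ f U V)) (∈-cartesianProductWith⁺ f u∈ v∈)

  data Image (g : P → Q) (U : List⁺ P) : Q → Set ℓ where
    image : ∀ {u} → u ∈⁺ U → Image g U (g u)

  image⁻ : (g : P → Q) (U : List⁺ P) → ∀ {x} → x ∈⁺ L⁺.map g U → Image g U x
  image⁻ g (u ∷ us) x∈ with ∈-map⁻ g x∈
  ... | _ , u∈ , refl = image u∈

  image⁺ : (g : P → Q) (U : List⁺ P) → ∀ {u} → u ∈⁺ U → g u ∈⁺ L⁺.map g U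
  image⁺ g (u ∷ us) = ∈-map⁺ g

  singleton⁻ : ∀ {a x : P} → x ∈⁺ [ a ] → x ≡ a
  singleton⁻ (here x≡a) = x≡a

  _∈≈_ : A ⇒ B → List⁺ (A ⇒ B) → Set (ℓ ⊔ e)
  _∈≈_ = _∈ₚ_ raw

  _⊆≈_ : List⁺ (A ⇒ B) → List⁺ (A ⇒ B) → Set (ℓ ⊔ e)
  _⊆≈_ = _⊆ₚ_ raw

  -- U ⊑ V: every element of U is matched, up to ≈, by one of V.  This is
  -- the function form of U ⊆ₚ V, convenient to prove by taking x apart.
  _⊑_ : List⁺ (A ⇒ B) → List⁺ (A ⇒ B) → Set (ℓ ⊔ e)
  U ⊑ V = ∀ {x} → x ∈⁺ U → x ∈≈ V

  matched : ∀ {V : List⁺ (A ⇒ B)} {x y} → y ∈⁺ V → x ≈ y → x ∈≈ V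
  matched = lose

  ⊑⇒⊆≈ : {U V : List⁺ (A ⇒ B)} → U ⊑ V → U ⊆≈ V
  ⊑⇒⊆≈ = All.tabulate

  ⊑-antisym : {U V : List⁺ (A ⇒ B)} → U ⊑ V → V ⊑ U → U P.≈ V
  ⊑-antisym U⊑V V⊑U = ⊑⇒⊆≈ U⊑V , ⊑⇒⊆≈ V⊑U

  ⊆≈-witness : {U V : List⁺ (A ⇒ B)} → U ⊆≈ V →
               ∀ {u} → u ∈⁺ U → Σ (A ⇒ B) λ v → v ∈⁺ V × u ≈ v
  ⊆≈-witness U⊆V u∈ = find (All.lookup U⊆V u∈)

  ⊆≈-refl : {U : List⁺ (A ⇒ B)} → U ⊆≈ U
  ⊆≈-refl = ⊑⇒⊆≈ λ u∈ → matched u∈ ≈.refl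

  ⊆≈-trans : {U V W : List⁺ (A ⇒ B)} → U ⊆≈ V → V ⊆≈ W → U ⊆≈ W
  ⊆≈-trans {A} {B} U⊆V V⊆W = All.map (All.lookupₛ (hom A B) (∈-resp-≈ (hom A B)) V⊆W) U⊆V

  ≈ₚ-isEquivalence : IsEquivalence (P._≈_ {A} {B})
  ≈ₚ-isEquivalence = record
    { refl  = ⊆≈-refl , ⊆≈-refl
    ; sym   = λ (U⊆V , V⊆U) → V⊆U , U⊆V
    ; trans = λ (U⊆V , V⊆U) (V⊆W , W⊆V) → ⊆≈-trans U⊆V V⊆W , ⊆≈-trans W⊆V V⊆U
    }

  image₂-mono : (f : A ⇒ B → X ⇒ Y → Z ⇒ W) →
                (∀ {a a′ b b′} → a ≈ a′ → b ≈ b′ → f a b ≈ f a′ b′) →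
                ∀ {U U′ V V′} → U ⊆≈ U′ → V ⊆≈ V′ → image₂ raw f U V ⊑ image₂ raw f U′ V′
  image₂-mono f f-resp {U} {U′} {V} {V′} U⊆U′ V⊆V′ x∈ with image₂⁻ f U V x∈
  ... | image u∈ v∈ with ⊆≈-witness U⊆U′ u∈ | ⊆≈-witness V⊆V′ v∈
  ... | _ , u′∈ , u≈u′ | _ , v′∈ , v≈v′ = matched (image₂⁺ f U′ V′ u′∈ v′∈) (f-resp u≈u′ v≈v′)

  image₂-cong : (f : A ⇒ B → X ⇒ Y → Z ⇒ W) →
                (∀ {a a′ b b′} → a ≈ a′ → b ≈ b′ → f a b ≈ f a′ b′) →
                ∀ {U U′ V V′} → U P.≈ U′ → V P.≈ V′ →
                image₂ raw f U V P.≈ image₂ raw f U′ V′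
  image₂-cong f f-resp (U⊆U′ , U′⊆U) (V⊆V′ , V′⊆V) =
    ⊑-antisym (image₂-mono f f-resp U⊆U′ V⊆V′) (image₂-mono f f-resp U′⊆U V′⊆V)

  image-mono : (g : A ⇒ B → X ⇒ Y) → (∀ {a a′} → a ≈ a′ → g a ≈ g a′) →
               ∀ {U V} → U ⊆≈ V → L⁺.map g U ⊑ L⁺.map g V
  image-mono g g-resp {U} {V} U⊆V x∈ with image⁻ g U x∈
  ... | image u∈ with ⊆≈-witness U⊆V u∈
  ... | _ , v∈ , u≈v = matched (image⁺ g V v∈) (g-resp u≈v)

  singleton-cong : {f g : A ⇒ B} → f ≈ g → [ f ] P.≈ [ g ]
  singleton-cong f≈g = (here f≈g ∷ []) , (here (≈.sym f≈g) ∷ [])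

  singleton-faithful : {f g : A ⇒ B} → [ f ] P.≈ [ g ] → f ≈ g
  singleton-faithful (here f≈g ∷ [] , _) = f≈g
  singleton-faithful (there () ∷ [] , _)

  ∘-elem⁻ : (G : List⁺ (B ⇒ X)) (F : List⁺ (A ⇒ B)) → ∀ {x} → x ∈⁺ G P.∘ F → Image₂ _∘_ G F x
  ∘-elem⁻ = image₂⁻ _∘_

  ∘-elem⁺ : (G : List⁺ (B ⇒ X)) (F : List⁺ (A ⇒ B)) →
            ∀ {g f} → g ∈⁺ G → f ∈⁺ F → g ∘ f ∈⁺ G P.∘ F
  ∘-elem⁺ = image₂⁺ _∘_

  -- The category laws, each as two inclusions obtained from the law in C;
  -- a name ending in ⊒ is the reverse inclusion of the one ending in ⊑.
  ∘-assoc⊑ : (F : List⁺ (A ⇒ B)) (G : List⁺ (B ⇒ X)) (H : List⁺ (X ⇒ Y)) →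
             (H P.∘ G) P.∘ F ⊑ H P.∘ (G P.∘ F)
  ∘-assoc⊑ F G H x∈ with ∘-elem⁻ (H P.∘ G) F x∈
  ... | image hg∈ f∈ with ∘-elem⁻ H G hg∈
  ... | image h∈ g∈ = matched (∘-elem⁺ H (G P.∘ F) h∈ (∘-elem⁺ G F g∈ f∈)) assoc

  ∘-assoc⊒ : (F : List⁺ (A ⇒ B)) (G : List⁺ (B ⇒ X)) (H : List⁺ (X ⇒ Y)) →
             H P.∘ (G P.∘ F) ⊑ (H P.∘ G) P.∘ F
  ∘-assoc⊒ F G H x∈ with ∘-elem⁻ H (G P.∘ F) x∈
  ... | image h∈ gf∈ with ∘-elem⁻ G F gf∈
  ... | image g∈ f∈ = matched (∘-elem⁺ (H P.∘ G) F (∘-elem⁺ H G h∈ g∈) f∈) (≈.sym assoc)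

  ∘-identityˡ⊑ : (F : List⁺ (A ⇒ B)) → P.id P.∘ F ⊑ F
  ∘-identityˡ⊑ F x∈ with ∘-elem⁻ P.id F x∈
  ... | image i∈ f∈ rewrite singleton⁻ i∈ = matched f∈ identityˡ

  ∘-identityˡ⊒ : (F : List⁺ (A ⇒ B)) → F ⊑ P.id P.∘ F
  ∘-identityˡ⊒ F f∈ = matched (∘-elem⁺ P.id F (here refl) f∈) (≈.sym identityˡ)

  ∘-identityʳ⊑ : (F : List⁺ (A ⇒ B)) → F P.∘ P.id ⊑ F
  ∘-identityʳ⊑ F x∈ with ∘-elem⁻ F P.id x∈
  ... | image f∈ i∈ rewrite singleton⁻ i∈ = matched f∈ identityʳ

  ∘-identityʳ⊒ : (F : List⁺ (A ⇒ B)) → F ⊑ F P.∘ P.id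
  ∘-identityʳ⊒ F f∈ = matched (∘-elem⁺ F P.id f∈ (here refl)) (≈.sym identityʳ)

  powerset-isCategory : IsCategory (PCat raw)
  powerset-isCategory = record
    { equiv     = ≈ₚ-isEquivalence
    ; assoc     = λ {_ _ _ _ F G H} → ⊑-antisym (∘-assoc⊑ F G H) (∘-assoc⊒ F G H)
    ; identityˡ = λ {_ _ F} → ⊑-antisym (∘-identityˡ⊑ F) (∘-identityˡ⊒ F)
    ; identityʳ = λ {_ _ F} → ⊑-antisym (∘-identityʳ⊑ F) (∘-identityʳ⊒ F)
    ; ∘-resp-≈  = image₂-cong _∘_ ∘-resp-≈
    }

  module CompactClosed (D : CCData raw) (cc : IsCompactClosed raw D) where
    open CCData D
    open IsCompactClosed cc
    private
      module PD = CCData (PData raw D)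

    ⊗-elem⁻ : (F : List⁺ (A ⇒ B)) (G : List⁺ (X ⇒ Y)) →
              ∀ {x} → x ∈⁺ F PD.⊗₁ G → Image₂ _⊗₁_ F G x
    ⊗-elem⁻ = image₂⁻ _⊗₁_

    ⊗-elem⁺ : (F : List⁺ (A ⇒ B)) (G : List⁺ (X ⇒ Y)) →
              ∀ {f g} → f ∈⁺ F → g ∈⁺ G → f ⊗₁ g ∈⁺ F PD.⊗₁ G
    ⊗-elem⁺ = image₂⁺ _⊗₁_

    ⊗-homo⊑ : (F : List⁺ (A ⇒ B)) (G : List⁺ (B ⇒ X)) (H : List⁺ (Y ⇒ Z)) (I : List⁺ (Z ⇒ W)) →
              (G P.∘ F) PD.⊗₁ (I P.∘ H) ⊑ (G PD.⊗₁ I) P.∘ (F PD.⊗₁ H)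
    ⊗-homo⊑ F G H I x∈ with ⊗-elem⁻ (G P.∘ F) (I P.∘ H) x∈
    ... | image gf∈ ih∈ with ∘-elem⁻ G F gf∈ | ∘-elem⁻ I H ih∈
    ... | image g∈ f∈ | image i∈ h∈ =
      matched (∘-elem⁺ (G PD.⊗₁ I) (F PD.⊗₁ H) (⊗-elem⁺ G I g∈ i∈) (⊗-elem⁺ F H f∈ h∈)) ⊗-homo

    ⊗-homo⊒ : (F : List⁺ (A ⇒ B)) (G : List⁺ (B ⇒ X)) (H : List⁺ (Y ⇒ Z)) (I : List⁺ (Z ⇒ W)) →
              (G PD.⊗₁ I) P.∘ (F PD.⊗₁ H) ⊑ (G P.∘ F) PD.⊗₁ (I P.∘ H)
    ⊗-homo⊒ F G H I x∈ with ∘-elem⁻ (G PD.⊗₁ I) (F PD.⊗₁ H) x∈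
    ... | image gi∈ fh∈ with ⊗-elem⁻ G I gi∈ | ⊗-elem⁻ F H fh∈
    ... | image g∈ i∈ | image f∈ h∈ =
      matched (⊗-elem⁺ (G P.∘ F) (I P.∘ H) (∘-elem⁺ G F g∈ f∈) (∘-elem⁺ I H i∈ h∈)) (≈.sym ⊗-homo)

    α-natural⊑ : (F : List⁺ (A ⇒ B)) (G : List⁺ (X ⇒ Y)) (H : List⁺ (Z ⇒ W)) →
                 PD.α⇒ B Y W P.∘ ((F PD.⊗₁ G) PD.⊗₁ H) ⊑ (F PD.⊗₁ (G PD.⊗₁ H)) P.∘ PD.α⇒ A X Z
    α-natural⊑ F G H x∈ with ∘-elem⁻ (PD.α⇒ _ _ _) ((F PD.⊗₁ G) PD.⊗₁ H) x∈
    ... | image a∈ fgh∈ with singleton⁻ a∈ | ⊗-elem⁻ (F PD.⊗₁ G) H fgh∈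
    ... | refl | image fg∈ h∈ with ⊗-elem⁻ F G fg∈
    ... | image f∈ g∈ =
      matched (∘-elem⁺ (F PD.⊗₁ (G PD.⊗₁ H)) (PD.α⇒ _ _ _)
                       (⊗-elem⁺ F (G PD.⊗₁ H) f∈ (⊗-elem⁺ G H g∈ h∈)) (here refl))
              (α-natural _ _ _)

    α-natural⊒ : (F : List⁺ (A ⇒ B)) (G : List⁺ (X ⇒ Y)) (H : List⁺ (Z ⇒ W)) →
                 (F PD.⊗₁ (G PD.⊗₁ H)) P.∘ PD.α⇒ A X Z ⊑ PD.α⇒ B Y W P.∘ ((F PD.⊗₁ G) PD.⊗₁ H)
    α-natural⊒ F G H x∈ with ∘-elem⁻ (F PD.⊗₁ (G PD.⊗₁ H)) (PD.α⇒ _ _ _) x∈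
    ... | image fgh∈ a∈ with singleton⁻ a∈ | ⊗-elem⁻ F (G PD.⊗₁ H) fgh∈
    ... | refl | image f∈ gh∈ with ⊗-elem⁻ G H gh∈
    ... | image g∈ h∈ =
      matched (∘-elem⁺ (PD.α⇒ _ _ _) ((F PD.⊗₁ G) PD.⊗₁ H)
                       (here refl) (⊗-elem⁺ (F PD.⊗₁ G) H (⊗-elem⁺ F G f∈ g∈) h∈))
              (≈.sym (α-natural _ _ _))

    λ-natural⊑ : (F : List⁺ (A ⇒ B)) → PD.λ⇒ B P.∘ (P.id PD.⊗₁ F) ⊑ F P.∘ PD.λ⇒ A
    λ-natural⊑ F x∈ with ∘-elem⁻ (PD.λ⇒ _) (P.id PD.⊗₁ F) x∈
    ... | image l∈ if∈ with singleton⁻ l∈ | ⊗-elem⁻ P.id F if∈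
    ... | refl | image i∈ f∈ rewrite singleton⁻ i∈ =
      matched (∘-elem⁺ F (PD.λ⇒ _) f∈ (here refl)) (λ-natural _)

    λ-natural⊒ : (F : List⁺ (A ⇒ B)) → F P.∘ PD.λ⇒ A ⊑ PD.λ⇒ B P.∘ (P.id PD.⊗₁ F)
    λ-natural⊒ F x∈ with ∘-elem⁻ F (PD.λ⇒ _) x∈
    ... | image f∈ l∈ rewrite singleton⁻ l∈ =
      matched (∘-elem⁺ (PD.λ⇒ _) (P.id PD.⊗₁ F) (here refl) (⊗-elem⁺ P.id F (here refl) f∈))
              (≈.sym (λ-natural _))

    ρ-natural⊑ : (F : List⁺ (A ⇒ B)) → PD.ρ⇒ B P.∘ (F PD.⊗₁ P.id) ⊑ F P.∘ PD.ρ⇒ A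
    ρ-natural⊑ F x∈ with ∘-elem⁻ (PD.ρ⇒ _) (F PD.⊗₁ P.id) x∈
    ... | image r∈ fi∈ with singleton⁻ r∈ | ⊗-elem⁻ F P.id fi∈
    ... | refl | image f∈ i∈ rewrite singleton⁻ i∈ =
      matched (∘-elem⁺ F (PD.ρ⇒ _) f∈ (here refl)) (ρ-natural _)

    ρ-natural⊒ : (F : List⁺ (A ⇒ B)) → F P.∘ PD.ρ⇒ A ⊑ PD.ρ⇒ B P.∘ (F PD.⊗₁ P.id)
    ρ-natural⊒ F x∈ with ∘-elem⁻ F (PD.ρ⇒ _) x∈
    ... | image f∈ r∈ rewrite singleton⁻ r∈ =
      matched (∘-elem⁺ (PD.ρ⇒ _) (F PD.⊗₁ P.id) (here refl) (⊗-elem⁺ F P.id f∈ (here refl)))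
              (≈.sym (ρ-natural _))

    σ-natural⊑ : (F : List⁺ (A ⇒ B)) (G : List⁺ (X ⇒ Y)) →
                 PD.σ B Y P.∘ (F PD.⊗₁ G) ⊑ (G PD.⊗₁ F) P.∘ PD.σ A X
    σ-natural⊑ F G x∈ with ∘-elem⁻ (PD.σ _ _) (F PD.⊗₁ G) x∈
    ... | image s∈ fg∈ with singleton⁻ s∈ | ⊗-elem⁻ F G fg∈
    ... | refl | image f∈ g∈ =
      matched (∘-elem⁺ (G PD.⊗₁ F) (PD.σ _ _) (⊗-elem⁺ G F g∈ f∈) (here refl)) (σ-natural _ _)

    σ-natural⊒ : (F : List⁺ (A ⇒ B)) (G : List⁺ (X ⇒ Y)) →
                 (G PD.⊗₁ F) P.∘ PD.σ A X ⊑ PD.σ B Y P.∘ (F PD.⊗₁ G)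
    σ-natural⊒ F G x∈ with ∘-elem⁻ (G PD.⊗₁ F) (PD.σ _ _) x∈
    ... | image gf∈ s∈ with singleton⁻ s∈ | ⊗-elem⁻ G F gf∈
    ... | refl | image g∈ f∈ =
      matched (∘-elem⁺ (PD.σ _ _) (F PD.⊗₁ G) (here refl) (⊗-elem⁺ F G f∈ g∈))
              (≈.sym (σ-natural _ _))

    powerset-isCompactClosed : IsCompactClosed (PCat raw) (PData raw D)
    powerset-isCompactClosed = record
      { ⊗-identity   = singleton-cong ⊗-identity
      ; ⊗-homo       = λ {_ _ _ _ _ _ F G H I} → ⊑-antisym (⊗-homo⊑ F G H I) (⊗-homo⊒ F G H I)
      ; ⊗-resp-≈     = image₂-cong _⊗₁_ ⊗-resp-≈
      ; α-isoˡ       = λ A B X → singleton-cong (α-isoˡ A B X)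
      ; α-isoʳ       = λ A B X → singleton-cong (α-isoʳ A B X)
      ; λ-isoˡ       = λ A → singleton-cong (λ-isoˡ A)
      ; λ-isoʳ       = λ A → singleton-cong (λ-isoʳ A)
      ; ρ-isoˡ       = λ A → singleton-cong (ρ-isoˡ A)
      ; ρ-isoʳ       = λ A → singleton-cong (ρ-isoʳ A)
      ; α-natural    = λ F G H → ⊑-antisym (α-natural⊑ F G H) (α-natural⊒ F G H)
      ; λ-natural    = λ F → ⊑-antisym (λ-natural⊑ F) (λ-natural⊒ F)
      ; ρ-natural    = λ F → ⊑-antisym (ρ-natural⊑ F) (ρ-natural⊒ F)
      ; σ-natural    = λ F G → ⊑-antisym (σ-natural⊑ F G) (σ-natural⊒ F G)
      ; triangle     = λ A B → singleton-cong (triangle A B)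
      ; pentagon     = λ A B X Y → singleton-cong (pentagon A B X Y)
      ; hexagon      = λ A B X → singleton-cong (hexagon A B X)
      ; σ-involutive = λ A B → singleton-cong (σ-involutive A B)
      ; snake₁       = λ A → singleton-cong (snake₁ A)
      ; snake₂       = λ A → singleton-cong (snake₂ A)
      }

    -- f ↦ {f} is a faithful strict monoidal functor C → C_{P⁺_ω}: composites,
    -- tensors and structural maps of singletons are singletons on the nose.
    singleton-embedding : IsSingletonEmbedding raw D
    singleton-embedding = record
      { F-identity = singleton-cong ≈.refl
      ; F-homo     = λ _ _ → singleton-cong ≈.refl
      ; F-resp-≈   = singleton-cong
      ; F-faithful = singleton-faithful
      ; F-⊗        = λ _ _ → singleton-cong ≈.refl
      ; F-α⇒       = λ _ _ _ → singleton-cong ≈.refl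
      ; F-λ⇒       = λ _ → singleton-cong ≈.refl
      ; F-ρ⇒       = λ _ → singleton-cong ≈.refl
      ; F-σ        = λ _ _ → singleton-cong ≈.refl
      }

    module Dagger (Dg : DaggerData raw) (dcc : IsDaggerCompactClosed raw D Dg) where
      open DaggerData Dg
      open IsDaggerCompactClosed dcc hiding (isCompactClosed)
      private
        module PDg = DaggerData (PDagger raw Dg)

      †-elem⁻ : (F : List⁺ (A ⇒ B)) → ∀ {x} → x ∈⁺ F PDg.† → Image _† F x
      †-elem⁻ = image⁻ _†

      †-elem⁺ : (F : List⁺ (A ⇒ B)) → ∀ {f} → f ∈⁺ F → f † ∈⁺ F PDg.†
      †-elem⁺ = image⁺ _†

      †-homo⊑ : (F : List⁺ (A ⇒ B)) (G : List⁺ (B ⇒ X)) → (G P.∘ F) PDg.† ⊑ (F PDg.†) P.∘ (G PDg.†)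
      †-homo⊑ F G x∈ with †-elem⁻ (G P.∘ F) x∈
      ... | image gf∈ with ∘-elem⁻ G F gf∈
      ... | image g∈ f∈ = matched (∘-elem⁺ (F PDg.†) (G PDg.†) (†-elem⁺ F f∈) (†-elem⁺ G g∈)) †-homo

      †-homo⊒ : (F : List⁺ (A ⇒ B)) (G : List⁺ (B ⇒ X)) → (F PDg.†) P.∘ (G PDg.†) ⊑ (G P.∘ F) PDg.†
      †-homo⊒ F G x∈ with ∘-elem⁻ (F PDg.†) (G PDg.†) x∈
      ... | image f†∈ g†∈ with †-elem⁻ F f†∈ | †-elem⁻ G g†∈
      ... | image f∈ | image g∈ = matched (†-elem⁺ (G P.∘ F) (∘-elem⁺ G F g∈ f∈)) (≈.sym †-homo)

      †-involutive⊑ : (F : List⁺ (A ⇒ B)) → (F PDg.†) PDg.† ⊑ F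
      †-involutive⊑ F x∈ with †-elem⁻ (F PDg.†) x∈
      ... | image f†∈ with †-elem⁻ F f†∈
      ... | image f∈ = matched f∈ (†-involutive _)

      †-involutive⊒ : (F : List⁺ (A ⇒ B)) → F ⊑ (F PDg.†) PDg.†
      †-involutive⊒ F f∈ = matched (†-elem⁺ (F PDg.†) (†-elem⁺ F f∈)) (≈.sym (†-involutive _))

      †-⊗⊑ : (F : List⁺ (A ⇒ B)) (G : List⁺ (X ⇒ Y)) →
             (F PD.⊗₁ G) PDg.† ⊑ (F PDg.†) PD.⊗₁ (G PDg.†)
      †-⊗⊑ F G x∈ with †-elem⁻ (F PD.⊗₁ G) x∈
      ... | image fg∈ with ⊗-elem⁻ F G fg∈
      ... | image f∈ g∈ = matched (⊗-elem⁺ (F PDg.†) (G PDg.†) (†-elem⁺ F f∈) (†-elem⁺ G g∈)) (†-⊗ _ _)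

      †-⊗⊒ : (F : List⁺ (A ⇒ B)) (G : List⁺ (X ⇒ Y)) →
             (F PDg.†) PD.⊗₁ (G PDg.†) ⊑ (F PD.⊗₁ G) PDg.†
      †-⊗⊒ F G x∈ with ⊗-elem⁻ (F PDg.†) (G PDg.†) x∈
      ... | image f†∈ g†∈ with †-elem⁻ F f†∈ | †-elem⁻ G g†∈
      ... | image f∈ | image g∈ = matched (†-elem⁺ (F PD.⊗₁ G) (⊗-elem⁺ F G f∈ g∈)) (≈.sym (†-⊗ _ _))

      powerset-isDaggerCompactClosed : IsDaggerCompactClosed (PCat raw) (PData raw D) (PDagger raw Dg)
      powerset-isDaggerCompactClosed = record
        { isCompactClosed = powerset-isCompactClosed
        ; †-identity      = singleton-cong †-identity
        ; †-homo          = λ {_ _ _ F G} → ⊑-antisym (†-homo⊑ F G) (†-homo⊒ F G)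
        ; †-involutive    = λ F → ⊑-antisym (†-involutive⊑ F) (†-involutive⊒ F)
        ; †-resp-≈        = λ (U⊆V , V⊆U) → ⊑-antisym (image-mono _† †-resp-≈ U⊆V)
                                                       (image-mono _† †-resp-≈ V⊆U)
        ; †-⊗             = λ F G → ⊑-antisym (†-⊗⊑ F G) (†-⊗⊒ F G)
        ; α-unitary       = λ A B X → singleton-cong (α-unitary A B X)
        ; λ-unitary       = λ A → singleton-cong (λ-unitary A)
        ; ρ-unitary       = λ A → singleton-cong (ρ-unitary A)
        ; σ-unitary       = λ A B → singleton-cong (σ-unitary A B)
        ; η-ε             = λ A → singleton-cong (η-ε A)
        }

mainTheorem5 : ∀ {o ℓ e} (C : Category o ℓ e) (D : CCData (Category.raw C)) →
    IsCompactClosed (Category.raw C) D →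
    IsCategory (PCat (Category.raw C))
    × IsCompactClosed (PCat (Category.raw C)) (PData (Category.raw C) D)
    × IsSingletonEmbedding (Category.raw C) D
    × ((Dg : DaggerData (Category.raw C)) →
       IsDaggerCompactClosed (Category.raw C) D Dg →
       IsDaggerCompactClosed (PCat (Category.raw C)) (PData (Category.raw C) D)
         (PDagger (Category.raw C) Dg))
mainTheorem5 C D cc =
  powerset-isCategory , powerset-isCompactClosed , singleton-embedding ,
  λ Dg dcc → Dagger.powerset-isDaggerCompactClosed Dg dcc
  where
  open FinitePowerset C
  open CompactClosed D cc
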